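{- Let $k\ge 1$ and let $G$ be a graph on $n$ vertices which has a homomorphism to $C_{2k+1}$. Then there is a tight homomorphism from $G$ to $C_{2k+1}$.
   Context: The cycle $C_{m}$ has as vertex set the congruence classes modulo $m$, with $i$ adjacent to $i+1$. A homomorphism from $G$ to $H$ is a map $h:V(G)\to V(H)$ sending edges to edges. A homomorphism $h$ from $G$ to $C_m$ is called tight if for every vertex $v$ with $h(v)\neq 0$ there exists a vertex $u$ adjacent to $v$ with $h(u)=h(v)+1$ (mod $m$). -}

module Defs where

open import Data.Nat using (ℕ; zero; suc; _+_; _*_; _%_)
open import Data.Fin using (Fin; toℕ; fromℕ<; zero)
open import Data.Nat.DivMod using (m%n<n)
open import Data.Product using (Σ; _×_; ∃-syntax)
open import Data.Sum using (_⊎_)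
open import Relation.Binary.PropositionalEquality using (_≡_)
open import Relation.Nullary using (¬_; Dec)

record Graph (n : ℕ) : Set₁ where
  field
    Adj   : Fin n → Fin n → Set
    dec   : ∀ u v → Dec (Adj u v)
    sym   : ∀ {u v} → Adj u v → Adj v u
    irrefl : ∀ {u} → ¬ Adj u u

next : {m : ℕ} → Fin (suc m) → Fin (suc m)
next {m} i = fromℕ< (m%n<n (suc (toℕ i)) (suc m))

CycAdj : {m : ℕ} → Fin (suc m) → Fin (suc m) → Set
CycAdj i j = (j ≡ next i) ⊎ (i ≡ next j)

IsHom : {n m : ℕ} → Graph n → (Fin n → Fin (suc m)) → Set
IsHom G h = ∀ u v → Graph.Adj G u v → CycAdj (h u) (h v)

IsTight : {n m : ℕ} → Graph n → (Fin n → Fin (suc m)) → Set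
IsTight G h = IsHom G h ×
  (∀ v → ¬ (h v ≡ zero) → ∃[ u ] (Graph.Adj G v u × h u ≡ next (h v)))

{-# OPTIONS --safe #-}
-- If h is not tight at v, i.e. h v ≠ 0 and no neighbour of v is mapped to
-- h v + 1, then every neighbour of v is mapped to h v − 1, so v may be moved
-- to h v − 2 and h remains a homomorphism.  On an odd cycle, iterating
-- x ↦ x − 2 from any x reaches 0, so the total number of such steps still
-- needed by the vertices strictly decreases with every move, and the process
-- ends at a tight homomorphism.
module Submission where

open import Defs
open import Data.Nat using (ℕ; suc; zero; _+_; _*_; _%_; _≤_; _<_; s≤s)
open import Data.Nat.Properties using (+-monoˡ-<; +-monoʳ-<; +-suc; +-identityʳ; n<1+n; ≤-reflexive; module ≤-Reasoning)
open import Data.Nat.Induction using (<-wellFounded)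
open import Data.Nat.DivMod using (m%n<n; n%n≡0; m<n⇒m%n≡m)
open import Data.Fin using (Fin; zero; suc; toℕ; fromℕ; inject₁)
open import Data.Fin.Properties using (_≟_; toℕ-injective; toℕ<n; toℕ-fromℕ<; toℕ-fromℕ; toℕ-inject₁; any?; all?; ¬∀⟶∃¬)
open import Data.Fin.Relation.Unary.Top using (view; ‵fromℕ; ‵inject₁)
open import Data.Vec.Functional using (Vector; updateAt)
open import Data.Vec.Functional.Properties using (updateAt-updates; updateAt-minimal)
open import Algebra.Properties.Monoid.Sum Data.Nat.Properties.+-0-monoid using (sum)
open import Data.Product using (∃-syntax; _×_; _,_)
open import Data.Sum using (_⊎_; inj₁; inj₂; swap)
open import Data.Empty using (⊥-elim)
open import Function using (_∘_; _on_)
open import Induction.WellFounded using (Acc; acc)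
open import Relation.Binary.Construct.On using (wellFounded)
open import Relation.Nullary using (¬_; Dec; yes; no)
open import Relation.Nullary.Decidable using (_×-dec_; _⊎-dec_)
open import Relation.Binary.PropositionalEquality using (_≡_; _≢_; refl; sym; trans; cong; subst₂; module ≡-Reasoning)

prev : {m : ℕ} → Fin (suc m) → Fin (suc m)
prev {m} zero = fromℕ m
prev (suc i) = inject₁ i

next-fromℕ : (m : ℕ) → next (fromℕ m) ≡ zero
next-fromℕ m = toℕ-injective (begin
  toℕ (next (fromℕ m))        ≡⟨ toℕ-fromℕ< (m%n<n (suc (toℕ (fromℕ m))) (suc m)) ⟩
  suc (toℕ (fromℕ m)) % suc m ≡⟨ cong (λ a → suc a % suc m) (toℕ-fromℕ m) ⟩
  suc m % suc m               ≡⟨ n%n≡0 (suc m) ⟩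
  0                           ∎)
  where open ≡-Reasoning

next-inject₁ : {m : ℕ} (i : Fin m) → next (inject₁ i) ≡ suc i
next-inject₁ {m} i = toℕ-injective (begin
  toℕ (next (inject₁ i))          ≡⟨ toℕ-fromℕ< (m%n<n (suc (toℕ (inject₁ i))) (suc m)) ⟩
  suc (toℕ (inject₁ i)) % suc m   ≡⟨ cong (λ a → suc a % suc m) (toℕ-inject₁ i) ⟩
  suc (toℕ i) % suc m             ≡⟨ m<n⇒m%n≡m (s≤s (toℕ<n i)) ⟩
  suc (toℕ i)                     ∎)
  where open ≡-Reasoning

next-prev : {m : ℕ} (x : Fin (suc m)) → next (prev x) ≡ x
next-prev {m} zero = next-fromℕ m
next-prev (suc i) = next-inject₁ i

prev-next : {m : ℕ} (x : Fin (suc m)) → prev (next x) ≡ x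
prev-next {m} x with view x
... | ‵fromℕ rewrite next-fromℕ m = refl
... | ‵inject₁ i rewrite next-inject₁ i = refl

sum-map-updateAt-< : ∀ {n} {A : Set} (g : A → ℕ) (xs : Vector A n) (i : Fin n) {f : A → A} →
  g (f (xs i)) < g (xs i) → sum (g ∘ updateAt xs i f) < sum (g ∘ xs)
sum-map-updateAt-< g xs zero    lt = +-monoˡ-< (sum (g ∘ xs ∘ suc)) lt
sum-map-updateAt-< g xs (suc i) lt = +-monoʳ-< (g (xs zero)) (sum-map-updateAt-< g (xs ∘ suc) i lt)

module _ {n m : ℕ} (G : Graph n) where
  open Graph G renaming (sym to Adj-sym)

  updateAt-isHom : ∀ {h : Fin n → Fin (suc m)} {v f} → IsHom G h →
    (∀ u → Adj v u → CycAdj (f (h v)) (h u)) → IsHom G (updateAt h v f)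
  updateAt-isHom {h} {v} hom moved w₁ w₂ a with w₁ ≟ v | w₂ ≟ v
  ... | yes refl | yes refl = ⊥-elim (irrefl a)
  ... | yes refl | no w₂≢v = subst₂ CycAdj
    (sym (updateAt-updates w₁ h)) (sym (updateAt-minimal w₂ w₁ h w₂≢v)) (moved w₂ a)
  ... | no w₁≢v | yes refl = subst₂ CycAdj
    (sym (updateAt-minimal w₁ w₂ h w₁≢v)) (sym (updateAt-updates w₂ h)) (swap (moved w₁ (Adj-sym a)))
  ... | no w₁≢v | no w₂≢v = subst₂ CycAdj
    (sym (updateAt-minimal w₁ v h w₁≢v)) (sym (updateAt-minimal w₂ v h w₂≢v)) (hom w₁ w₂ a)

  TightAt : (Fin n → Fin (suc m)) → Fin n → Set
  TightAt h v = h v ≡ zero ⊎ ∃[ u ] (Adj v u × h u ≡ next (h v))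

  tightAt? : ∀ h v → Dec (TightAt h v)
  tightAt? h v = (h v ≟ zero) ⊎-dec any? (λ u → dec v u ×-dec (h u ≟ next (h v)))

  tight-or-untightAt : ∀ {h} → IsHom G h → IsTight G h ⊎ ∃[ v ] ¬ TightAt h v
  tight-or-untightAt {h} hom with all? (tightAt? h)
  ... | no ¬all = inj₂ (¬∀⟶∃¬ n (TightAt h) (tightAt? h) ¬all)
  ... | yes all = inj₁ (hom , λ v hv≢0 → up-neighbour (all v) hv≢0)
    where
    up-neighbour : ∀ {v} → TightAt h v → h v ≢ zero → ∃[ u ] (Adj v u × h u ≡ next (h v))
    up-neighbour (inj₁ hv≡0) hv≢0 = ⊥-elim (hv≢0 hv≡0)
    up-neighbour (inj₂ up)   _    = up

  untightAt-neighbour : ∀ {h v u} → IsHom G h → ¬ TightAt h v → Adj v u → h u ≡ prev (h v)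
  untightAt-neighbour {h} {v} {u} hom ¬tight a with hom v u a
  ... | inj₁ up   = ⊥-elim (¬tight (inj₂ (u , a , up)))
  ... | inj₂ down = trans (sym (prev-next (h u))) (cong prev (sym down))

  retreat-isHom : ∀ {h v} → IsHom G h → ¬ TightAt h v → IsHom G (updateAt h v (prev ∘ prev))
  retreat-isHom {h} {v} hom ¬tight = updateAt-isHom hom λ u a →
    inj₁ (trans (untightAt-neighbour hom ¬tight a) (sym (next-prev (prev (h v)))))

  module _ (μ : Fin (suc m) → ℕ) (μ-prev² : ∀ x → x ≢ zero → μ (prev (prev x)) < μ x) where

    potential : (Fin n → Fin (suc m)) → ℕ
    potential h = sum (μ ∘ h)

    potential-retreat : ∀ {h v} → ¬ TightAt h v → potential (updateAt h v (prev ∘ prev)) < potential h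
    potential-retreat {h} {v} ¬tight = sum-map-updateAt-< μ h v (μ-prev² (h v) (¬tight ∘ inj₁))

    tighten : ∀ h → Acc (_<_ on potential) h → IsHom G h → ∃[ t ] IsTight G t
    tighten h (acc smaller) hom with tight-or-untightAt hom
    ... | inj₁ tight        = h , tight
    ... | inj₂ (v , ¬tight) =
      tighten (updateAt h v (prev ∘ prev)) (smaller (potential-retreat ¬tight)) (retreat-isHom hom ¬tight)

    tight-from-hom : ∀ {h} → IsHom G h → ∃[ t ] IsTight G t
    tight-from-hom {h} = tighten h (wellFounded potential <-wellFounded h)

-- In C_(2k+1), stepsToZero k x is the number of steps x ↦ x − 2 leading from x
-- to 0: the even x = 2j take j steps, the odd x = 2j + 1 take k + 1 + j.  On an
-- even cycle the odd vertices never reach 0, so no such potential exists.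
stepsToZero : ℕ → ℕ → ℕ
stepsToZero k zero          = 0
stepsToZero k (suc zero)    = suc k
stepsToZero k (suc (suc x)) = suc (stepsToZero k x)

stepsToZero-double : ∀ k j → stepsToZero k (j + j) ≡ j
stepsToZero-double k zero = refl
stepsToZero-double k (suc j) rewrite +-suc j j = cong suc (stepsToZero-double k j)

stepsToZero-prev² : ∀ {k m} → m ≡ 2 * k → (x : Fin (suc m)) → x ≢ zero →
  stepsToZero k (toℕ (prev (prev x))) < stepsToZero k (toℕ x)
stepsToZero-prev² _ zero x≢0 = ⊥-elim (x≢0 refl)
stepsToZero-prev² {k} {suc m} m≡2k (suc zero) _ = begin-strict
  stepsToZero k (toℕ (fromℕ (suc m))) ≡⟨ cong (stepsToZero k) (trans (toℕ-fromℕ (suc m)) m≡2k) ⟩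
  stepsToZero k (k + (k + 0))         ≡⟨ cong (stepsToZero k ∘ (k +_)) (+-identityʳ k) ⟩
  stepsToZero k (k + k)               ≡⟨ stepsToZero-double k k ⟩
  k                                   <⟨ n<1+n k ⟩
  suc k                               ∎
  where open ≤-Reasoning
stepsToZero-prev² {k} _ (suc (suc j)) _ =
  ≤-reflexive (cong (suc ∘ stepsToZero k) (trans (toℕ-inject₁ (inject₁ j)) (toℕ-inject₁ j)))

lemma1 : (k : ℕ) → 1 ≤ k → (n : ℕ) → (G : Graph n) →
    ∃[ h ] IsHom {n} {2 * k} G h →
    ∃[ t ] IsTight {n} {2 * k} G t
lemma1 k _ n G (h , hom) = tight-from-hom G (stepsToZero k ∘ toℕ) (stepsToZero-prev² refl) hom
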